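{- Let $p\ge3$ be a prime with $r$ even, and let $U_k,V_k$ be defined by $U_0=0$, $U_1=1$, $V_0=1$, $V_1=0$, $U_k=rU_{k-1}-sU_{k-2}$, $V_k=rV_{k-1}-sV_{k-2}$ for $k\ge2$. Then for all $k\ge0$, \[rU_{\nu(p)k+\nu(p)-1}+V_{\nu(p)k+\nu(p)-1}\equiv0\pmod 8.\]
   Context: $f_m=(q^m;q^m)_\infty$; $\sum_{n\ge0}a(n)q^n=f_1^4f_2$. For a prime $p\ge3$, $r=a\left(\frac{p^2-1}{4}\right)+(-1)^{\frac{p-1}{2}}p\left(\frac{(p^2-1)/4}{p}\right)_L$ (Legendre symbol), $s=p^3$. $\nu(p)=2$ if $r\equiv0\pmod8$, $\nu(p)=4$ if $r\equiv4\pmod8$, $\nu(p)=8$ if $r\equiv2\pmod4$. -}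

module Defs where

open import Data.Nat as ℕ using (ℕ; zero; suc)
open import Data.Integer as ℤ using (ℤ; +_; -[1+_]; _%ℕ_)
open import Data.List using (List; []; _∷_; replicate; lookup; length)
open import Data.Bool using (Bool; true; false; if_then_else_)
open import Data.Nat.Primality using (Prime)

-- Truncated power series over ℤ: the coefficient list c₀, …, c_N
-- (all of length N+1) of a series modulo q^(N+1).

coeff : List ℤ → ℕ → ℤ
coeff []       _       = + 0
coeff (c ∷ cs) zero    = c
coeff (c ∷ cs) (suc i) = coeff cs i

sumTo : ℕ → (ℕ → ℤ) → ℤ
sumTo zero    f = f 0
sumTo (suc n) f = sumTo n f ℤ.+ f (suc n)

tab : ℕ → (ℕ → ℤ) → List ℤ
tab N f = go N 0
  where
  go : ℕ → ℕ → List ℤ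
  go zero    i = f i ∷ []
  go (suc k) i = f i ∷ go k (suc i)

mulTrunc : ℕ → List ℤ → List ℤ → List ℤ
mulTrunc N a b = tab N (λ n → sumTo n (λ j → coeff a j ℤ.* coeff b (n ℕ.∸ j)))

oneMinusQ^ : ℕ → List ℤ
oneMinusQ^ d = + 1 ∷ (replicate (d ℕ.∸ 1) (+ 0) Data.List.++ (ℤ.- (+ 1)) ∷ [])
  where import Data.List

prodTrunc : ℕ → ℕ → ℕ → List ℤ
prodTrunc N e zero    = tab N (λ { zero → + 1 ; (suc _) → + 0 })
prodTrunc N e (suc M) = mulTrunc N (prodTrunc N e M) (oneMinusQ^ (e ℕ.* suc M))

-- f_e = (q^e;q^e)_∞ = ∏_{m≥1}(1-q^{em}), truncated mod q^(N+1);
-- factors with m > N do not affect coefficients up to q^N (e ≥ 1).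
fTrunc : ℕ → ℕ → List ℤ
fTrunc N e = prodTrunc N e N

a : ℕ → ℤ
a n = coeff (mulTrunc n f1 (mulTrunc n f1 (mulTrunc n f1 (mulTrunc n f1 (fTrunc n 2))))) n
  where f1 = fTrunc n 1

isSquareMod : (x p : ℕ) .{{_ : ℕ.NonZero p}} → Bool
isSquareMod x p = search p
  where
  search : ℕ → Bool
  search zero    = false
  search (suc y) = if (y ℕ.* y) ℕ.% p ℕ.≡ᵇ x ℕ.% p then true else search y

legendre : (x p : ℕ) .{{_ : ℕ.NonZero p}} → ℤ
legendre x p with x ℕ.% p
... | zero  = + 0
... | suc _ = if isSquareMod x p then + 1 else ℤ.- (+ 1)

N₀ : ℕ → ℕ
N₀ p = (p ℕ.* p ℕ.∸ 1) ℕ./ 4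

signP : ℕ → ℤ
signP p = if ((p ℕ.∸ 1) ℕ./ 2) ℕ.% 2 ℕ.≡ᵇ 0 then + 1 else ℤ.- (+ 1)

r : (p : ℕ) .{{_ : ℕ.NonZero p}} → ℤ
r p = a (N₀ p) ℤ.+ signP p ℤ.* (+ p) ℤ.* legendre (N₀ p) p

s : ℕ → ℤ
s p = + (p ℕ.^ 3)

-- ν(p) = 2 if r ≡ 0 (mod 8), 4 if r ≡ 4 (mod 8), 8 if r ≡ 2 (mod 4)
-- (for odd r, which the paper does not cover, we set ν = 8; the theorem
--  below only concerns even r, where the three cases are exhaustive)
ν : (p : ℕ) .{{_ : ℕ.NonZero p}} → ℕ
ν p with r p %ℕ 8
... | 0 = 2
... | 4 = 4
... | _ = 8

U : ℤ → ℤ → ℕ → ℤ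
U R S 0 = + 0
U R S 1 = + 1
U R S (suc (suc k)) = R ℤ.* U R S (suc k) ℤ.- S ℤ.* U R S k

V : ℤ → ℤ → ℕ → ℤ
V R S 0 = + 1
V R S 1 = + 0
V R S (suc (suc k)) = R ℤ.* V R S (suc k) ℤ.- S ℤ.* V R S k

-- Since V (n+1) = -s U n, the sum r U n + V n is U (n+1), so the claim is that 8 divides
-- U at every positive multiple of ν. By the addition formula
-- U (n+m+1) = U (m+1) U (n+1) - s U m U n, any d dividing U v divides U at all multiples
-- of v, so it suffices that 8 ∣ U ν. The doubling formula U (2n) = (2 U (n+1) - r U n) U n
-- shows that, for even r, every doubling of the index gains a factor 2; starting from
-- U 2 = r, this gives 8 ∣ U 2, U 4, U 8 when 8, 4, 2 divide r respectively, which is how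
-- ν is chosen. Nothing about p is used beyond the parity of r.
module Submission where

open import Defs
open import Data.Nat as ℕ using (ℕ; zero; suc; NonZero)
open import Data.Nat.Primality using (Prime)
import Data.Nat.Properties as ℕ
open import Data.Integer as ℤ using (ℤ; +_; _+_; _-_; _*_; -_; _%ℕ_; _/ℕ_)
open import Data.Integer.Divisibility using (_∣_)
open import Data.Integer.Divisibility.Signed as Signed
  using (divides; ∣-refl; ∣-trans; ∣m∣n⇒∣m+n; ∣m∣n⇒∣m-n; ∣m⇒∣m*n; ∣n⇒∣m*n; *-monoʳ-∣; *-monoˡ-∣; ∣ᵤ⇒∣; ∣⇒∣ᵤ)
open import Data.Integer.Properties using (*-zeroʳ; *-identityʳ; +-identityˡ; +-identityʳ)
open import Data.Integer.DivMod using (a≡a%ℕn+[a/ℕn]*n)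
open import Data.Integer.Tactic.RingSolver using (solve-∀)
open import Data.Product using (_×_; _,_)
open import Relation.Binary.PropositionalEquality using (_≡_; refl; sym; cong; cong₂; subst; module ≡-Reasoning)

%ℕ≡⇒∣ : ∀ {d m n t} .{{_ : NonZero n}} → m %ℕ n ≡ t → d Signed.∣ + n → d Signed.∣ + t → d Signed.∣ m
%ℕ≡⇒∣ {d} {m} {n} refl d∣n d∣t =
  subst (d Signed.∣_) (sym (a≡a%ℕn+[a/ℕn]*n m n)) (∣m∣n⇒∣m+n d∣t (∣n⇒∣m*n (m /ℕ n) d∣n))

module _ (R S : ℤ) where

  open ≡-Reasoning

  V-suc : ∀ n → V R S (suc n) ≡ - (S * U R S n)
  V-suc zero rewrite *-zeroʳ S = refl
  V-suc (suc zero) rewrite *-zeroʳ R | *-identityʳ S = +-identityˡ (- S)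
  V-suc (suc (suc n)) = begin
    R * V R S (suc (suc n)) - S * V R S (suc n)
      ≡⟨ cong₂ (λ x y → R * x - S * y) (V-suc (suc n)) (V-suc n) ⟩
    R * - (S * U R S (suc n)) - S * - (S * U R S n)
      ≡⟨ ring R S (U R S (suc n)) (U R S n) ⟩
    - (S * U R S (suc (suc n)))
      ∎
    where
    ring : ∀ R S a b → R * - (S * a) - S * - (S * b) ≡ - (S * (R * a - S * b))
    ring = solve-∀

  U-suc : ∀ n → U R S (suc n) ≡ R * U R S n + V R S n
  U-suc zero rewrite *-zeroʳ R = refl
  U-suc (suc n) = cong (λ x → R * U R S (suc n) + x) (sym (V-suc n))

  U-two : U R S 2 ≡ R
  U-two rewrite *-identityʳ R | *-zeroʳ S = +-identityʳ R

  ∣R⇒∣U₂ : ∀ {d} → d Signed.∣ R → d Signed.∣ U R S 2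
  ∣R⇒∣U₂ {d} = subst (d Signed.∣_) (sym U-two)

  U-add : ∀ n m → U R S (suc (n ℕ.+ m)) ≡ U R S (suc m) * U R S (suc n) - S * (U R S m * U R S n)
  U-add zero m = ring₀ S (U R S (suc m)) (U R S m)
    where
    ring₀ : ∀ S a b → a ≡ a * + 1 - S * (b * + 0)
    ring₀ = solve-∀
  U-add (suc zero) m = ring₁ R S (U R S (suc m)) (U R S m)
    where
    ring₁ : ∀ R S a b → R * a - S * b ≡ a * (R * + 1 - S * + 0) - S * (b * + 1)
    ring₁ = solve-∀
  U-add (suc (suc n)) m = begin
    R * U R S (suc (suc n) ℕ.+ m) - S * U R S (suc (n ℕ.+ m))
      ≡⟨ cong₂ (λ x y → R * x - S * y) (U-add (suc n) m) (U-add n m) ⟩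
    R * (x * U R S (suc (suc n)) - S * (y * U R S (suc n))) - S * (x * U R S (suc n) - S * (y * U R S n))
      ≡⟨ ring R S x y (U R S (suc n)) (U R S n) ⟩
    x * U R S (suc (suc (suc n))) - S * (y * U R S (suc (suc n)))
      ∎
    where
    x y : ℤ
    x = U R S (suc m)
    y = U R S m
    ring : ∀ R S a b d e →
           R * (a * (R * d - S * e) - S * (b * d)) - S * (a * d - S * (b * e))
           ≡ a * (R * (R * d - S * e) - S * d) - S * (b * (R * d - S * e))
    ring = solve-∀

  U-double : ∀ n → U R S (n ℕ.+ n) ≡ (+ 2 * U R S (suc n) - R * U R S n) * U R S n
  U-double zero rewrite *-zeroʳ (+ 2 * + 1 - R * + 0) = refl
  U-double (suc n) = begin
    U R S (suc (n ℕ.+ suc n))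
      ≡⟨ U-add n (suc n) ⟩
    U R S (suc (suc n)) * U R S (suc n) - S * (U R S (suc n) * U R S n)
      ≡⟨ ring R S (U R S (suc n)) (U R S n) ⟩
    (+ 2 * U R S (suc (suc n)) - R * U R S (suc n)) * U R S (suc n)
      ∎
    where
    ring : ∀ R S a b → (R * a - S * b) * a - S * (a * b) ≡ (+ 2 * (R * a - S * b) - R * a) * a
    ring = solve-∀

  ∣U⇒∣U[k*v] : ∀ {d} v → d Signed.∣ U R S v → ∀ k → d Signed.∣ U R S (k ℕ.* v)
  ∣U⇒∣U[k*v] v d∣Uv zero = divides (+ 0) refl
  ∣U⇒∣U[k*v] zero _ k rewrite ℕ.*-zeroʳ k = divides (+ 0) refl
  ∣U⇒∣U[k*v] {d} (suc w) d∣Uv (suc k) = subst (d Signed.∣_) (sym (U-add w (k ℕ.* suc w)))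
    (∣m∣n⇒∣m-n (∣n⇒∣m*n (U R S (suc (k ℕ.* suc w))) d∣Uv)
                (∣n⇒∣m*n S (∣m⇒∣m*n (U R S w) (∣U⇒∣U[k*v] (suc w) d∣Uv k))))

  ∣U⇒∣R*U+V : ∀ {d} v .{{_ : NonZero v}} → d Signed.∣ U R S v → ∀ k →
              d Signed.∣ R * U R S (v ℕ.* k ℕ.+ v ℕ.∸ 1) + V R S (v ℕ.* k ℕ.+ v ℕ.∸ 1)
  ∣U⇒∣R*U+V {d} (suc w) d∣Uv k = subst (d Signed.∣_) (U-suc (suc w ℕ.* k ℕ.+ suc w ℕ.∸ 1))
    (subst (λ i → d Signed.∣ U R S i) (sym index) (∣U⇒∣U[k*v] (suc w) d∣Uv (suc k)))
    where
    index : suc (suc w ℕ.* k ℕ.+ suc w ℕ.∸ 1) ≡ suc k ℕ.* suc w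
    index = cong suc (begin
      suc w ℕ.* k ℕ.+ suc w ℕ.∸ 1 ≡⟨ ℕ.+-∸-assoc (suc w ℕ.* k) (ℕ.s≤s ℕ.z≤n) ⟩
      suc w ℕ.* k ℕ.+ w           ≡⟨ ℕ.+-comm (suc w ℕ.* k) w ⟩
      w ℕ.+ suc w ℕ.* k           ≡⟨ cong (w ℕ.+_) (ℕ.*-comm (suc w) k) ⟩
      w ℕ.+ k ℕ.* suc w           ∎)

  ∣U⇒2*∣U[n+n] : ∀ {d} n → + 2 Signed.∣ R → d Signed.∣ U R S n → + 2 * d Signed.∣ U R S (n ℕ.+ n)
  ∣U⇒2*∣U[n+n] {d} n 2∣R d∣Un = subst (+ 2 * d Signed.∣_) (sym (U-double n))
    (∣-trans (*-monoʳ-∣ (+ 2) d∣Un) (*-monoˡ-∣ (U R S n) 2∣2U-RU))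
    where
    2∣2U-RU : + 2 Signed.∣ + 2 * U R S (suc n) - R * U R S n
    2∣2U-RU = ∣m∣n⇒∣m-n (∣m⇒∣m*n (U R S (suc n)) ∣-refl) (∣m⇒∣m*n (U R S n) 2∣R)

  8∣U₄ : + 4 Signed.∣ R → + 8 Signed.∣ U R S 4
  8∣U₄ 4∣R = ∣U⇒2*∣U[n+n] 2 (∣-trans (divides (+ 2) refl) 4∣R) (∣R⇒∣U₂ 4∣R)

  8∣U₈ : + 2 Signed.∣ R → + 8 Signed.∣ U R S 8
  8∣U₈ 2∣R = ∣U⇒2*∣U[n+n] 4 2∣R (∣U⇒2*∣U[n+n] 2 2∣R (∣R⇒∣U₂ 2∣R))

nonZero-ν×8∣U[ν] : ∀ p .{{_ : NonZero p}} → + 2 Signed.∣ r p →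
                   NonZero (ν p) × + 8 Signed.∣ U (r p) (s p) (ν p)
nonZero-ν×8∣U[ν] p 2∣r with r p %ℕ 8 in r%8
... | 0 = _ , ∣R⇒∣U₂ (r p) (s p) (%ℕ≡⇒∣ r%8 ∣-refl (divides (+ 0) refl))
... | 4 = _ , 8∣U₄ (r p) (s p) (%ℕ≡⇒∣ r%8 (divides (+ 2) refl) ∣-refl)
-- The other residues are split only so that ν p computes to 8.
... | 1 = _ , 8∣U₈ (r p) (s p) 2∣r
... | 2 = _ , 8∣U₈ (r p) (s p) 2∣r
... | 3 = _ , 8∣U₈ (r p) (s p) 2∣r
... | suc (suc (suc (suc (suc _)))) = _ , 8∣U₈ (r p) (s p) 2∣r

lemma8p2 : (p : ℕ) → .{{_ : ℕ.NonZero p}} → 3 ℕ.≤ p → Prime p → (+ 2) ∣ r p →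
           (k : ℕ) →
           (+ 8) ∣ (r p ℤ.* U (r p) (s p) (ν p ℕ.* k ℕ.+ ν p ℕ.∸ 1) ℤ.+ V (r p) (s p) (ν p ℕ.* k ℕ.+ ν p ℕ.∸ 1))
lemma8p2 p _ _ 2∣r k with nonZero-ν×8∣U[ν] p (∣ᵤ⇒∣ 2∣r)
... | ν≢0 , 8∣U[ν] = ∣⇒∣ᵤ (∣U⇒∣R*U+V (r p) (s p) (ν p) {{ν≢0}} 8∣U[ν] k)
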